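{- Let $R$ be a commutative ring with unity, $P\in R[x_1,\dots,x_n]$, and let $(J_0,\dots,J_l,d_0,\dots,d_{m-1})$ be an upper Rado functional of order $m\ge1$ for $P$. Then each of the sets $J_0,\dots,J_l$ is homogeneous.
   Context: $\operatorname{supp}(P)\subseteq\mathbb{N}_0^n$ is the set of exponent vectors of monomials of $P$ with nonzero coefficient; $|\alpha|=\alpha(1)+\dots+\alpha(n)$; a set $J\subseteq\mathbb{N}_0^n$ is homogeneous if $|\alpha|=|\beta|$ for all $\alpha,\beta\in J$. For $\vec t\in\mathbb{N}^n$, $\alpha\cdot\vec t=\sum_j\alpha(j)t_j$. An upper Rado functional of order $m$ ($0\le m\le l$) is a tuple $(J_0,\dots,J_l,d_0,\dots,d_{m-1})$, with $J_0,\dots,J_l$ a partition of $\operatorname{supp}(P)$ into nonempty sets and $d_i\in\mathbb{N}$, such that for every $r\in\mathbb{N}$ and every finite coloring $c$ of $\mathbb{N}$ there are infinitely many $\vec t\in\mathbb{N}^n$ with $c(t_1)=\dots=c(t_n)$ for which there exist integers $M_0>\dots>M_l$ with $J_i=\{\alpha\in\operatorname{supp}(P):\alpha\cdot\vec t=M_i\}$ for all $i$, $M_i-M_m=d_i$ for $i\in\{0,\dots,m-1\}$, and (if $m<l$) $M_m-M_{m+1}\ge r$. -}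

module Defs where

open import Level using (Level; _⊔_)
open import Algebra.Bundles using (CommutativeRing)
open import Data.Nat as ℕ using (ℕ; suc; _≤_; _<_)
open import Data.Integer as ℤ using (ℤ; +_; _-_)
open import Data.Fin as Fin using (Fin; toℕ; fromℕ<; inject≤)
open import Data.Vec using (Vec; lookup; zipWith; sum)
open import Data.List using (List)
open import Data.Nat.Properties using (m≤n⇒m≤1+n)
open import Data.List.Membership.Propositional using (_∈_)
open import Data.Product using (Σ; ∃; _×_; _,_)
open import Relation.Nullary using (¬_)
open import Relation.Binary.PropositionalEquality using (_≡_)

Exp : ℕ → Set
Exp n = Vec ℕ n

∣_∣ₑ : ∀ {n} → Exp n → ℕ
∣ α ∣ₑ = sum α

_·_ : ∀ {n} → Exp n → Vec ℕ n → ℕ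
α · t = sum (zipWith ℕ._*_ α t)

record Poly {c ℓ : Level} (R : CommutativeRing c ℓ) (n : ℕ) : Set (c ⊔ ℓ) where
  open CommutativeRing R
  field
    coeff       : Exp n → Carrier
    support     : List (Exp n)
    finite-supp : ∀ α → ¬ (α ∈ support) → coeff α ≈ 0#

Supp : ∀ {c ℓ} {R : CommutativeRing c ℓ} {n} → Poly R n → Exp n → Set ℓ
Supp {R = R} P α = ¬ (Poly.coeff P α ≈ 0#)
  where open CommutativeRing R

Homogeneous : ∀ {n} → (Exp n → Set) → Set
Homogeneous J = ∀ α β → J α → J β → ∣ α ∣ₑ ≡ ∣ β ∣ₑ

-- Upper Rado functional (J₀,…,J_l,d₀,…,d_{m-1}) of order m (0 ≤ m ≤ l) for P.
-- Indices i : Fin (suc l) stand for 0,…,l; ℕ (positive integers) is encoded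
-- as ℕ₀ with a positivity side condition where relevant.
record UpperRado {c ℓ} {R : CommutativeRing c ℓ} {n : ℕ} (P : Poly R n)
                 (l m : ℕ) (m≤l : m ≤ l) : Set (Level.suc ℓ) where
  field
    J        : Fin (suc l) → Exp n → Set
    d        : Fin m → ℕ
    d-pos    : ∀ i → 1 ≤ d i
    J⊆supp   : ∀ i α → J i α → Supp P α
    supp⊆J   : ∀ α → Supp P α → ∃ λ i → J i α
    disjoint : ∀ i j α → J i α → J j α → i ≡ j
    nonempty : ∀ i → ∃ λ α → J i α
    rado : ∀ (r k : ℕ) (col : ℕ → Fin k) (B : ℕ) →
      Σ (Vec ℕ n) λ t →
        (∀ j → 1 ≤ lookup t j) ×
        (∃ λ j → B < lookup t j) ×
        (∀ j j′ → col (lookup t j) ≡ col (lookup t j′)) ×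
        Σ (Fin (suc l) → ℤ) λ M →
          (∀ i i′ → toℕ i < toℕ i′ → M i′ ℤ.< M i) ×
          (∀ i α → (J i α → Supp P α × (+ (α · t) ≡ M i)) ×
                   (Supp P α → + (α · t) ≡ M i → J i α)) ×
          (∀ (i : Fin m) → M (inject≤ i (m≤n⇒m≤1+n m≤l)) - M (fromℕ< (ℕ.s≤s m≤l)) ≡ + d i) ×
          (∀ (m<l : m < l) → + r ℤ.≤ M (fromℕ< (ℕ.s≤s m≤l)) - M (fromℕ< (ℕ.s≤s m<l)))

-- If some t is monochromatic for the colouring by residues modulo a large
-- prime p, then all t_j are congruent to one residue a, so α · t ≡ ∣α∣ a (mod p).
-- The order m ≥ 1 supplies α₀ ∈ J₀ and β₀ ∈ J_m with α₀ · t = d₀ + β₀ · t, and as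
-- 0 < d₀ < p this forces p ∤ a. Two exponents of the same J_i have equal α · t,
-- hence ∣γ∣ a ≡ ∣δ∣ a (mod p), and cancelling a gives ∣γ∣ = ∣δ∣ once p exceeds both.
module Submission where

open import Defs
open import Algebra.Bundles using (CommutativeRing)
open import Data.Nat using (ℕ; _≤_)
open import Data.Fin using (Fin)
open import Data.Nat using (suc)

open import Data.Nat using (zero; _+_; _*_; _∸_; _%_; _<_; _!; NonZero; >-nonZero; s≤s; _≤?_)
open import Data.Nat.Properties
open import Data.Nat.DivMod using (_/_; _mod_; m≡m%n+[m/n]*n; m%n<n; %-distribˡ-+; %-distribˡ-*)
open import Data.Nat.Divisibility
open import Data.Nat.Primality using (Prime; euclidsLemma; prime⇒nonZero; ¬prime[1])
open import Data.Nat.Primality.Factorisation using (factorise)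
open import Data.List using ([]; _∷_)
open import Data.List.Relation.Unary.All using (_∷_)
open import Data.Vec using (Vec; []; _∷_; lookup)
open import Data.Fin as Fin using (toℕ; fromℕ<; inject≤)
open import Data.Fin.Properties using (toℕ-fromℕ<)
open import Data.Integer as ℤ using (+_)
import Data.Integer.Properties as ℤ
open import Algebra.Properties.AbelianGroup ℤ.+-0-abelianGroup using (//-rightDividesˡ)
open import Data.Product using (∃; _×_; _,_; proj₁; proj₂)
open import Data.Sum using (inj₁; inj₂)
open import Relation.Nullary using (¬_; yes; no; contradiction)
open import Relation.Binary.PropositionalEquality hiding (J)
open ≡-Reasoning

∃-prime-factor : ∀ {N} → 2 ≤ N → ∃ λ p → Prime p × p ∣ N
∃-prime-factor {N} 2≤N with factorise N {{>-nonZero (<⇒≤ 2≤N)}}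
... | record { factors = [] ; isFactorisation = N≡1 } =
  contradiction (subst (2 ≤_) N≡1 2≤N) λ { (s≤s ()) }
... | record { factors = p ∷ ps ; isFactorisation = N≡p*ps ; factorsPrime = p-prime ∷ _ } =
  p , p-prime , subst (p ∣_) (sym N≡p*ps) (m∣m*n _)

m≤n⇒m∣n! : ∀ {m n} .{{_ : NonZero m}} → m ≤ n → m ∣ n !
m≤n⇒m∣n! {suc k} m≤n = ∣-trans (m∣m*n (k !)) (m≤n⇒m!∣n! m≤n)

prime∣[n!+1]⇒n<p : ∀ {n p} → Prime p → p ∣ n ! + 1 → n < p
prime∣[n!+1]⇒n<p {n} {p} p-prime p∣n!+1 with p ≤? n
... | no p≰n = ≰⇒> p≰n
... | yes p≤n = contradiction (subst Prime (∣1⇒≡1 (∣m+n∣m⇒∣n p∣n!+1 p∣n!)) p-prime) ¬prime[1]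
  where
  p∣n! : p ∣ n !
  p∣n! = m≤n⇒m∣n! {{prime⇒nonZero p-prime}} p≤n

∃-prime-> : ∀ n → ∃ λ p → Prime p × n < p
∃-prime-> n with ∃-prime-factor {n ! + 1} (+-monoˡ-≤ 1 (1≤n! n))
... | p , p-prime , p∣n!+1 = p , p-prime , prime∣[n!+1]⇒n<p p-prime p∣n!+1

∣∧<⇒≡0 : ∀ {p x} → p ∣ x → x < p → x ≡ 0
∣∧<⇒≡0 {x = zero}  _   _   = refl
∣∧<⇒≡0 {x = suc _} p∣x x<p = contradiction p∣x (>⇒∤ x<p)

+m-+n≡+o⇒m≡n+o : ∀ {x y z} → + x ℤ.- + y ≡ + z → x ≡ y + z
+m-+n≡+o⇒m≡n+o {x} {y} {z} x-y≡z = ℤ.+-injective (begin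
  + x                   ≡⟨ //-rightDividesˡ (+ y) (+ x) ⟨
  (+ x ℤ.- + y) ℤ.+ + y ≡⟨ cong (ℤ._+ + y) x-y≡z ⟩
  + z ℤ.+ + y           ≡⟨ ℤ.+-comm (+ z) (+ y) ⟩
  + (y + z)             ∎)

infix 4 _≡_[mod_]
_≡_[mod_] : ℕ → ℕ → (p : ℕ) → .{{NonZero p}} → Set
x ≡ y [mod p ] = x % p ≡ y % p

module _ {p : ℕ} .{{_ : NonZero p}} where

  mod-≡⇒≡[mod] : ∀ {x y} → x mod p ≡ y mod p → x ≡ y [mod p ]
  mod-≡⇒≡[mod] {x} {y} eq = begin
    x % p              ≡⟨ toℕ-fromℕ< (m%n<n x p) ⟨
    toℕ (x mod p)      ≡⟨ cong toℕ eq ⟩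
    toℕ (y mod p)      ≡⟨ toℕ-fromℕ< (m%n<n y p) ⟩
    y % p              ∎

  +-cong-mod : ∀ {a b c d} → a ≡ b [mod p ] → c ≡ d [mod p ] → a + c ≡ b + d [mod p ]
  +-cong-mod {a} {b} {c} {d} a≡b c≡d = begin
    (a + c) % p          ≡⟨ %-distribˡ-+ a c p ⟩
    (a % p + c % p) % p  ≡⟨ cong₂ (λ u v → (u + v) % p) a≡b c≡d ⟩
    (b % p + d % p) % p  ≡⟨ %-distribˡ-+ b d p ⟨
    (b + d) % p          ∎

  *-congˡ-mod : ∀ c {a b} → a ≡ b [mod p ] → c * a ≡ c * b [mod p ]
  *-congˡ-mod c {a} {b} a≡b = begin
    (c * a) % p          ≡⟨ %-distribˡ-* c a p ⟩
    (c % p * (a % p)) % p ≡⟨ cong (λ u → (c % p * u) % p) a≡b ⟩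
    (c % p * (b % p)) % p ≡⟨ %-distribˡ-* c b p ⟨
    (c * b) % p          ∎

  ≡[mod]⇒∣∸ : ∀ {x y} → x ≡ y [mod p ] → p ∣ x ∸ y
  ≡[mod]⇒∣∸ {x} {y} x≡y = divides (x / p ∸ y / p) (begin
    x ∸ y                                        ≡⟨ cong₂ _∸_ (m≡m%n+[m/n]*n x p) (m≡m%n+[m/n]*n y p) ⟩
    (x % p + x / p * p) ∸ (y % p + y / p * p)   ≡⟨ cong (λ r → (r + x / p * p) ∸ (y % p + y / p * p)) x≡y ⟩
    (y % p + x / p * p) ∸ (y % p + y / p * p)   ≡⟨ [m+n]∸[m+o]≡n∸o (y % p) _ _ ⟩
    x / p * p ∸ y / p * p                        ≡⟨ *-distribʳ-∸ p (x / p) (y / p) ⟨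
    (x / p ∸ y / p) * p                          ∎)

  ∣-resp-≡[mod] : ∀ {x y} → x ≡ y [mod p ] → p ∣ y → p ∣ x
  ∣-resp-≡[mod] {x} {y} x≡y p∣y = m%n≡0⇒n∣m x p (trans x≡y (n∣m⇒m%n≡0 y p p∣y))

  ·-≡-∣∣ₑ*-mod : ∀ {n a} (α t : Vec ℕ n) → (∀ j → lookup t j ≡ a [mod p ]) →
                 α · t ≡ ∣ α ∣ₑ * a [mod p ]
  ·-≡-∣∣ₑ*-mod {a = a} [] [] _ = cong (_% p) (sym (*-zeroˡ a))
  ·-≡-∣∣ₑ*-mod {a = a} (x ∷ α) (y ∷ t) t≡a = begin
    (x * y + α · t) % p      ≡⟨ +-cong-mod (*-congˡ-mod x (t≡a Fin.zero))
                                            (·-≡-∣∣ₑ*-mod α t (λ j → t≡a (Fin.suc j))) ⟩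
    (x * a + ∣ α ∣ₑ * a) % p ≡⟨ cong (_% p) (*-distribʳ-+ a x ∣ α ∣ₑ) ⟨
    ((x + ∣ α ∣ₑ) * a) % p   ∎

  module _ (p-prime : Prime p) {a : ℕ} (p∤a : ¬ p ∣ a) where

    *-cancelʳ-∸-mod : ∀ {g h} → g < p → g * a ≡ h * a [mod p ] → g ∸ h ≡ 0
    *-cancelʳ-∸-mod {g} {h} g<p ga≡ha with euclidsLemma (g ∸ h) a p-prime p∣[g∸h]a
      where
      p∣[g∸h]a : p ∣ (g ∸ h) * a
      p∣[g∸h]a = subst (p ∣_) (sym (*-distribʳ-∸ a g h)) (≡[mod]⇒∣∸ ga≡ha)
    ... | inj₁ p∣g∸h = ∣∧<⇒≡0 p∣g∸h (≤-<-trans (m∸n≤m g h) g<p)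
    ... | inj₂ p∣a   = contradiction p∣a p∤a

    *-cancelʳ-mod : ∀ {g h} → g < p → h < p → g * a ≡ h * a [mod p ] → g ≡ h
    *-cancelʳ-mod {g} {h} g<p h<p ga≡ha = ≤-antisym
      (m∸n≡0⇒m≤n (*-cancelʳ-∸-mod {g} {h} g<p ga≡ha))
      (m∸n≡0⇒m≤n (*-cancelʳ-∸-mod {h} {g} h<p (sym ga≡ha)))

  module _ {n a} {t : Vec ℕ n} (t≡a : ∀ j → lookup t j ≡ a [mod p ]) where

    p∤a-of-gap : ∀ {d} (α β : Vec ℕ n) → α · t ≡ β · t + d → 0 < d → d < p → ¬ p ∣ a
    p∤a-of-gap {d} α β α·t≡β·t+d 0<d d<p p∣a =
      contradiction (∣∧<⇒≡0 p∣d d<p) (>⇒≢ 0<d)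
      where
      p∣·t : ∀ γ → p ∣ γ · t
      p∣·t γ = ∣-resp-≡[mod] (·-≡-∣∣ₑ*-mod γ t t≡a) (∣n⇒∣m*n ∣ γ ∣ₑ p∣a)
      p∣d : p ∣ d
      p∣d = ∣m+n∣m⇒∣n (subst (p ∣_) α·t≡β·t+d (p∣·t α)) (p∣·t β)

    ∣∣ₑ-injective-on-· : Prime p → ¬ p ∣ a → ∀ γ δ → ∣ γ ∣ₑ < p → ∣ δ ∣ₑ < p →
                         γ · t ≡ δ · t → ∣ γ ∣ₑ ≡ ∣ δ ∣ₑ
    ∣∣ₑ-injective-on-· p-prime p∤a γ δ γ<p δ<p γ·t≡δ·t =
      *-cancelʳ-mod p-prime p∤a γ<p δ<p (begin
        (∣ γ ∣ₑ * a) % p ≡⟨ ·-≡-∣∣ₑ*-mod γ t t≡a ⟨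
        (γ · t) % p      ≡⟨ cong (_% p) γ·t≡δ·t ⟩
        (δ · t) % p      ≡⟨ ·-≡-∣∣ₑ*-mod δ t t≡a ⟩
        (∣ δ ∣ₑ * a) % p ∎)

module _ {c ℓ} {R : CommutativeRing c ℓ} {n l m} {P : Poly R (suc n)} {m≤l : suc m ≤ l}
         (F : UpperRado P l (suc m) m≤l) where
  open UpperRado F

  homogeneous-below-prime : ∀ {p} .{{_ : NonZero p}} → Prime p → d Fin.zero < p →
    ∀ i {γ δ} → J i γ → J i δ → ∣ γ ∣ₑ < p → ∣ δ ∣ₑ < p → ∣ γ ∣ₑ ≡ ∣ δ ∣ₑ
  homogeneous-below-prime {p} p-prime d₀<p i {γ} {δ} γ∈Jᵢ δ∈Jᵢ γ<p δ<p
    with rado 0 p (_mod p) 0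
       | nonempty (inject≤ Fin.zero (m≤n⇒m≤1+n m≤l))
       | nonempty (fromℕ< (s≤s m≤l))
  ... | t , _ , _ , monochromatic , M , _ , J-level , gap , _ | α₀ , α₀∈J₀ | β₀ , β₀∈Jₘ =
    ∣∣ₑ-injective-on-· t≡a p-prime p∤a γ δ γ<p δ<p
      (ℤ.+-injective (trans (level γ∈Jᵢ) (sym (level δ∈Jᵢ))))
    where
    a : ℕ
    a = lookup t Fin.zero
    t≡a : ∀ j → lookup t j ≡ a [mod p ]
    t≡a j = mod-≡⇒≡[mod] (monochromatic j Fin.zero)
    level : ∀ {k α} → J k α → + (α · t) ≡ M k
    level {k} {α} α∈Jₖ = proj₂ (proj₁ (J-level k α) α∈Jₖ)
    p∤a : ¬ p ∣ a
    p∤a = p∤a-of-gap t≡a α₀ β₀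
      (+m-+n≡+o⇒m≡n+o (trans (cong₂ ℤ._-_ (level α₀∈J₀) (level β₀∈Jₘ)) (gap Fin.zero)))
      (d-pos Fin.zero) d₀<p

corollary2p10 : ∀ {c ℓ} (R : CommutativeRing c ℓ) (n : ℕ) (P : Poly R n)
                  (l m : ℕ) (m≤l : m ≤ l) → 1 ≤ m →
                  (F : UpperRado P l m m≤l) →
                  ∀ (i : Fin (suc l)) → Homogeneous (UpperRado.J F i)
corollary2p10 R zero    P l m       m≤l _       F i [] [] _ _ = refl
corollary2p10 R (suc n) P l (suc m) m≤l (s≤s _) F i γ δ γ∈Jᵢ δ∈Jᵢ =
  let (p , p-prime , bound) = ∃-prime-> (d₀ + (∣ γ ∣ₑ + ∣ δ ∣ₑ)) in
  homogeneous-below-prime F {{prime⇒nonZero p-prime}} p-prime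
    (≤-<-trans (m≤m+n d₀ _) bound) i γ∈Jᵢ δ∈Jᵢ
    (≤-<-trans (≤-trans (m≤m+n ∣ γ ∣ₑ ∣ δ ∣ₑ) (m≤n+m _ d₀)) bound)
    (≤-<-trans (≤-trans (m≤n+m ∣ δ ∣ₑ ∣ γ ∣ₑ) (m≤n+m _ d₀)) bound)
  where
  d₀ : ℕ
  d₀ = UpperRado.d F Fin.zero
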